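{- Let $\alpha_1,\alpha_2,\alpha_3,\alpha_4\in\mathcal{O}^\times$. Then for every odd integer $l$, $$\min\big\{v(\alpha_1+\alpha_2-\alpha_3-\alpha_4),\ v(\alpha_1^{ -1}+\alpha_2^{ -1}-\alpha_3^{ -1}-\alpha_4^{ -1})\big\}\le v(\alpha_1^l+\alpha_2^l-\alpha_3^l-\alpha_4^l).$$ If in addition $\alpha_1+\alpha_2\in\mathcal{O}^\times$, then this inequality holds for all integers $l$.
   Context: $F$ is a non-archimedean local field of characteristic $0$ with odd residue characteristic. It has ring of integers $\mathcal{O}$ and normalised valuation $v$ (with $v(0)=\infty$). -}

module Defs where

open import Level using (Level; _⊔_) renaming (suc to lsuc)
open import Algebra.Bundles using (CommutativeRing; Semiring)
open import Data.Nat as ℕ using (ℕ; zero; suc)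
open import Data.Integer as ℤ using (ℤ; +_; -[1+_])
open import Data.Product using (Σ; ∃; _×_; _,_)
open import Data.List using (List)
import Algebra.Definitions.RawSemiring as RS
open import Data.List.Relation.Unary.Any using (Any)
import Data.List.Relation.Unary.All
open import Relation.Binary.PropositionalEquality using (_≡_)
open import Relation.Nullary using (¬_)

data ℤ∞ : Set where
  fin : ℤ → ℤ∞
  ∞   : ℤ∞

infix 4 _≤∞_
data _≤∞_ : ℤ∞ → ℤ∞ → Set where
  fin≤fin : ∀ {a b} → a ℤ.≤ b → fin a ≤∞ fin b
  _≤∞∞    : ∀ x → x ≤∞ ∞

infixl 6 _+∞_
_+∞_ : ℤ∞ → ℤ∞ → ℤ∞
fin a +∞ fin b = fin (a ℤ.+ b)
fin a +∞ ∞     = ∞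
∞     +∞ _     = ∞

min∞ : ℤ∞ → ℤ∞ → ℤ∞
min∞ (fin a) (fin b) = fin (a ℤ.⊓ b)
min∞ (fin a) ∞       = fin a
min∞ ∞       y       = y

record LocalField (c ℓ : Level) : Set (lsuc (c ⊔ ℓ)) where
  field
    cring : CommutativeRing c ℓ
  open CommutativeRing cring public
  field
    inv     : Carrier → Carrier
    inv-law : ∀ x → ¬ (x ≈ 0#) → x * inv x ≈ 1#
    1≉0     : ¬ (1# ≈ 0#)
    char0   : ∀ n → ¬ (RS._×_ (Semiring.rawSemiring semiring) (suc n) 1# ≈ 0#)
    v       : Carrier → ℤ∞
    v-cong  : ∀ {x y} → x ≈ y → v x ≡ v y
    v-∞     : ∀ x → v x ≡ ∞ → x ≈ 0#
    v-0     : v 0# ≡ ∞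
    v-*     : ∀ x y → v (x * y) ≡ v x +∞ v y
    v-+     : ∀ x y → min∞ (v x) (v y) ≤∞ v (x + y)
    uniformiser : Σ Carrier (λ π → v π ≡ fin (+ 1))
    complete : (s : ℕ → Carrier) →
               (∀ k → ∃ λ N → ∀ m n → N ℕ.≤ m → N ℕ.≤ n →
                   fin (+ k) ≤∞ v (s m - s n)) →
               ∃ λ L → ∀ k → ∃ λ N → ∀ n → N ℕ.≤ n → fin (+ k) ≤∞ v (s n - L)
    -- finite residue field: finitely many elements of 𝒪 represent all of 𝒪 mod 𝔭
    residues        : List Carrier
    residues-in-𝒪   : Data.List.Relation.Unary.All.All (λ a → fin (+ 0) ≤∞ v a) residues
    residues-cover  : ∀ x → fin (+ 0) ≤∞ v x →
                      Any (λ a → fin (+ 1) ≤∞ v (x - a)) residues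
    -- odd residue characteristic: 2 is a unit in 𝒪
    residue-odd : v (1# + 1#) ≡ fin (+ 0)

  open RS (Semiring.rawSemiring semiring) public using (_^_) renaming (_×_ to _·×_)

  IsUnit𝒪 : Carrier → Set
  IsUnit𝒪 x = v x ≡ fin (+ 0)

  _^ℤ_ : Carrier → ℤ → Carrier
  x ^ℤ (+ n)     = x ^ n
  x ^ℤ -[1+ n ]  = inv x ^ suc n

  S : ℤ → Carrier → Carrier → Carrier → Carrier → Carrier
  S l a₁ a₂ a₃ a₄ = (((a₁ ^ℤ l) + (a₂ ^ℤ l)) - (a₃ ^ℤ l)) - (a₄ ^ℤ l)

  IsOdd : ℤ → Set
  IsOdd l = ∃ λ k → l ≡ (+ 2) ℤ.* k ℤ.+ (+ 1)

{-# OPTIONS --safe #-}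
module Submission where

open import Defs
open import Level using (Level)
open import Data.Integer using (ℤ; +_; -[1+_])
open import Data.Product using (_×_)
open import Relation.Binary.PropositionalEquality using (_≡_)

open import Algebra.Bundles using (CommutativeRing)
import Algebra.Solver.Ring
import Algebra.Solver.Ring.AlmostCommutativeRing as ACR
open import Data.Empty using (⊥-elim)
import Data.Integer as ℤ
import Data.Integer.Properties as ℤ
open import Data.Integer.Solver using (module +-*-Solver)
open import Data.Maybe using (Maybe; just; nothing)
open import Data.Nat as ℕ using (ℕ; zero; suc)
import Data.Nat.Properties as ℕ
open import Data.Product using (∃; _,_; proj₁; proj₂)
open import Data.Sign as Sign using (Sign)
open import Data.Sum using (_⊎_; inj₁; inj₂)
open import Relation.Binary.PropositionalEquality as ≡ using (_≢_)
open import Relation.Nullary using (¬_; yes; no)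

-- Write e = a + b, p = ab, e' = c + d, p' = cd and Δₖ = aᵏ + bᵏ − cᵏ − dᵏ, and let m be the
-- minimum of v(Δ₁) and v(Δ₋₁). Since Δ₁ = e − e' and pp'Δ₋₁ = p'e − pe', the identity
-- e(p − p') = pΔ₁ − pp'Δ₋₁ gives v(e(p − p')) ≥ m. Newton's identity for each pair gives
--   Δₖ₊₂ = eΔₖ₊₁ − pΔₖ + (e − e')(cᵏ⁺¹ + dᵏ⁺¹) − (p − p')(cᵏ + dᵏ),
-- so v(eΔₖ) ≥ m for all k ≥ 0 by induction, which is the claim for k ≥ 0 when e is a unit.
-- For odd k, cᵏ + dᵏ is divisible by e' and e'(p − p') = e(p − p') − Δ₁(p − p'), so the same
-- recurrence gives v(Δₖ) ≥ m along the odd k ≥ 1. Negative exponents follow by passing to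
-- a⁻¹, b⁻¹, c⁻¹, d⁻¹, which swaps Δ₁ with Δ₋₁ and multiplies e by the unit (ab)⁻¹.

-- Tactic.RingSolver takes its coefficients from the carrier, where an abstract ring cannot decide
-- that a coefficient vanishes; ℤ maps into every commutative ring and has decidable equality.
module IntegerCoefficientRingSolver {r ℓ} (R : CommutativeRing r ℓ) where
  open CommutativeRing R
  open import Algebra.Properties.Ring ring
  open import Algebra.Properties.Semiring.Mult semiring using (×-homo-+; ×1-homo-*)
    renaming (_×_ to _·×_)
  open import Relation.Binary.Reasoning.Setoid setoid

  ⟦_⟧ℤ : ℤ → Carrier
  ⟦ + n ⟧ℤ      = n ·× 1#
  ⟦ -[1+ n ] ⟧ℤ = - (suc n ·× 1#)

  signed : Sign → Carrier → Carrier
  signed Sign.+ x = x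
  signed Sign.- x = - x

  ⟦◃⟧ : ∀ s n → ⟦ s ℤ.◃ n ⟧ℤ ≈ signed s (n ·× 1#)
  ⟦◃⟧ Sign.+ zero    = refl
  ⟦◃⟧ Sign.+ (suc n) = refl
  ⟦◃⟧ Sign.- zero    = sym -0#≈0#
  ⟦◃⟧ Sign.- (suc n) = refl

  [o+x]-[o+y]≈x-y : ∀ o x y → (o + x) - (o + y) ≈ x - y
  [o+x]-[o+y]≈x-y o x y = begin
    (o + x) - (o + y)      ≈⟨ +-congˡ (-‿+-comm o y) ⟨
    (o + x) + (- o - y)    ≈⟨ +-congʳ (+-comm o x) ⟩
    (x + o) + (- o - y)    ≈⟨ +-assoc x o _ ⟩
    x + (o + (- o - y))    ≈⟨ +-congˡ (+-assoc o (- o) (- y)) ⟨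
    x + ((o - o) - y)      ≈⟨ +-congˡ (+-congʳ (-‿inverseʳ o)) ⟩
    x + (0# - y)           ≈⟨ +-congˡ (+-identityˡ (- y)) ⟩
    x - y                  ∎

  ⟦⊖⟧ : ∀ m n → ⟦ m ℤ.⊖ n ⟧ℤ ≈ m ·× 1# - n ·× 1#
  ⟦⊖⟧ m       zero    = sym (trans (+-congˡ -0#≈0#) (+-identityʳ _))
  ⟦⊖⟧ zero    (suc n) = sym (+-identityˡ _)
  ⟦⊖⟧ (suc m) (suc n) = begin
    ⟦ suc m ℤ.⊖ suc n ⟧ℤ        ≡⟨ ≡.cong ⟦_⟧ℤ (ℤ.[1+m]⊖[1+n]≡m⊖n m n) ⟩
    ⟦ m ℤ.⊖ n ⟧ℤ                ≈⟨ ⟦⊖⟧ m n ⟩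
    m ·× 1# - n ·× 1#           ≈⟨ [o+x]-[o+y]≈x-y 1# _ _ ⟨
    suc m ·× 1# - suc n ·× 1#   ∎

  ⟦+⟧ : ∀ i j → ⟦ i ℤ.+ j ⟧ℤ ≈ ⟦ i ⟧ℤ + ⟦ j ⟧ℤ
  ⟦+⟧ (+ m)    (+ n)    = ×-homo-+ 1# m n
  ⟦+⟧ (+ m)    -[1+ n ] = ⟦⊖⟧ m (suc n)
  ⟦+⟧ -[1+ m ] (+ n)    = trans (⟦⊖⟧ n (suc m)) (+-comm _ _)
  ⟦+⟧ -[1+ m ] -[1+ n ] = begin
    - (suc (suc (m ℕ.+ n)) ·× 1#)     ≡⟨ ≡.cong (λ k → - (suc k ·× 1#)) (ℕ.+-suc m n) ⟨
    - ((suc m ℕ.+ suc n) ·× 1#)       ≈⟨ -‿cong (×-homo-+ 1# (suc m) (suc n)) ⟩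
    - (suc m ·× 1# + suc n ·× 1#)     ≈⟨ -‿+-comm _ _ ⟨
    - (suc m ·× 1#) - (suc n ·× 1#)   ∎

  ⟦*⟧ : ∀ i j → ⟦ i ℤ.* j ⟧ℤ ≈ ⟦ i ⟧ℤ * ⟦ j ⟧ℤ
  ⟦*⟧ (+ m)    (+ n)    = trans (⟦◃⟧ Sign.+ (m ℕ.* n)) (×1-homo-* m n)
  ⟦*⟧ (+ m)    -[1+ n ] = trans (⟦◃⟧ Sign.- (m ℕ.* suc n))
    (trans (-‿cong (×1-homo-* m (suc n))) (-‿distribʳ-* _ _))
  ⟦*⟧ -[1+ m ] (+ n)    = trans (⟦◃⟧ Sign.- (suc m ℕ.* n))
    (trans (-‿cong (×1-homo-* (suc m) n)) (-‿distribˡ-* _ _))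
  ⟦*⟧ -[1+ m ] -[1+ n ] = begin
    ⟦ Sign.+ ℤ.◃ (suc m ℕ.* suc n) ⟧ℤ   ≈⟨ ⟦◃⟧ Sign.+ (suc m ℕ.* suc n) ⟩
    (suc m ℕ.* suc n) ·× 1#             ≈⟨ ×1-homo-* (suc m) (suc n) ⟩
    suc m ·× 1# * suc n ·× 1#           ≈⟨ -‿involutive _ ⟨
    - - (suc m ·× 1# * suc n ·× 1#)     ≈⟨ -‿cong (-‿distribˡ-* _ _) ⟩
    - (- (suc m ·× 1#) * suc n ·× 1#)   ≈⟨ -‿distribʳ-* _ _ ⟩
    - (suc m ·× 1#) * - (suc n ·× 1#)   ∎

  ⟦-⟧ : ∀ i → ⟦ ℤ.- i ⟧ℤ ≈ - ⟦ i ⟧ℤ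
  ⟦-⟧ -[1+ n ]    = sym (-‿involutive _)
  ⟦-⟧ (+ zero)    = sym -0#≈0#
  ⟦-⟧ (+ (suc n)) = refl

  homomorphism : ℤ.+-*-rawRing ACR.-Raw-AlmostCommutative⟶ ACR.fromCommutativeRing R
  homomorphism = record
    { ⟦_⟧    = ⟦_⟧ℤ
    ; +-homo = ⟦+⟧
    ; *-homo = ⟦*⟧
    ; -‿homo = ⟦-⟧
    ; 0-homo = refl
    ; 1-homo = +-identityʳ 1#
    }

  ⟦≟⟧ : ∀ i j → Maybe (⟦ i ⟧ℤ ≈ ⟦ j ⟧ℤ)
  ⟦≟⟧ i j with i ℤ.≟ j
  ... | yes ≡.refl = just refl
  ... | no _       = nothing

  open Algebra.Solver.Ring ℤ.+-*-rawRing (ACR.fromCommutativeRing R) homomorphism ⟦≟⟧ public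

≤∞-refl : ∀ x → x ≤∞ x
≤∞-refl (fin a) = fin≤fin ℤ.≤-refl
≤∞-refl ∞       = ∞ ≤∞∞

≤∞-trans : ∀ {x y z} → x ≤∞ y → y ≤∞ z → x ≤∞ z
≤∞-trans _           (_ ≤∞∞)     = _ ≤∞∞
≤∞-trans (fin≤fin p) (fin≤fin q) = fin≤fin (ℤ.≤-trans p q)

min∞-≤ˡ : ∀ x y → min∞ x y ≤∞ x
min∞-≤ˡ (fin a) (fin b) = fin≤fin (ℤ.i⊓j≤i a b)
min∞-≤ˡ (fin a) ∞       = ≤∞-refl (fin a)
min∞-≤ˡ ∞       y       = y ≤∞∞

min∞-≤ʳ : ∀ x y → min∞ x y ≤∞ y
min∞-≤ʳ (fin a) (fin b) = fin≤fin (ℤ.i⊓j≤j a b)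
min∞-≤ʳ (fin a) ∞       = fin a ≤∞∞
min∞-≤ʳ ∞       y       = ≤∞-refl y

min∞-glb : ∀ {m x y} → m ≤∞ x → m ≤∞ y → m ≤∞ min∞ x y
min∞-glb (_ ≤∞∞)     y≥m         = y≥m
min∞-glb (fin≤fin p) (fin≤fin q) = fin≤fin (ℤ.⊓-glb p q)
min∞-glb (fin≤fin p) (_ ≤∞∞)     = fin≤fin p

≤∞-+∞-nonneg : ∀ {m x y} → m ≤∞ x → fin (+ 0) ≤∞ y → m ≤∞ x +∞ y
≤∞-+∞-nonneg (_ ≤∞∞)     _                     = _ ≤∞∞
≤∞-+∞-nonneg (fin≤fin p) (_ ≤∞∞)               = _ ≤∞∞
≤∞-+∞-nonneg (fin≤fin p) (fin≤fin {b = + n} _) = fin≤fin (ℤ.≤-trans p (ℤ.i≤i+j _ (+ n)))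

+∞-identityˡ : ∀ x → fin (+ 0) +∞ x ≡ x
+∞-identityˡ (fin a) = ≡.cong fin (ℤ.+-identityˡ a)
+∞-identityˡ ∞       = ≡.refl

fin-injective : ∀ {a b} → fin a ≡ fin b → a ≡ b
fin-injective ≡.refl = ≡.refl

x≡x+∞x⇒x≡0 : ∀ x → x ≢ ∞ → x ≡ x +∞ x → x ≡ fin (+ 0)
x≡x+∞x⇒x≡0 (fin a) _   a≡a+a = ≡.cong fin (identityʳ-unique a a (≡.sym (fin-injective a≡a+a)))
  where open import Algebra.Properties.AbelianGroup ℤ.+-0-abelianGroup using (identityʳ-unique)
x≡x+∞x⇒x≡0 ∞       x≢∞ _ = ⊥-elim (x≢∞ ≡.refl)

x+∞x≡0⇒0≤x : ∀ x → x +∞ x ≡ fin (+ 0) → fin (+ 0) ≤∞ x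
x+∞x≡0⇒0≤x (fin (+ n))    _ = fin≤fin (ℤ.+≤+ ℕ.z≤n)
x+∞x≡0⇒0≤x (fin -[1+ n ]) ()
x+∞x≡0⇒0≤x ∞              ()

double : ℕ → ℕ
double zero    = zero
double (suc j) = suc (suc (double j))

double≡2*j : ∀ j → double j ≡ 2 ℕ.* j
double≡2*j zero    = ≡.refl
double≡2*j (suc j) = ≡.cong suc (≡.trans (≡.cong suc (double≡2*j j)) (≡.sym (ℕ.+-suc j (j ℕ.+ 0))))

2*j+1≡odd : ∀ j → + 2 ℤ.* + j ℤ.+ + 1 ≡ + suc (double j)
2*j+1≡odd j = ≡.trans (≡.cong (ℤ._+ + 1) (≡.sym (ℤ.pos-* 2 j)))
                      (≡.cong +_ (≡.trans (ℕ.+-comm (2 ℕ.* j) 1) (≡.cong suc (≡.sym (double≡2*j j)))))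

2*[-1-j]+1≡-odd : ∀ j → + 2 ℤ.* -[1+ j ] ℤ.+ + 1 ≡ -[1+ double j ]
2*[-1-j]+1≡-odd j = ≡.trans
  (solve 1 (λ x → con (+ 2) :* (:- (con (+ 1) :+ x)) :+ con (+ 1)
               := :- (con (+ 2) :* x :+ con (+ 1))) ≡.refl (+ j))
  (≡.cong ℤ.-_ (2*j+1≡odd j))
  where open +-*-Solver

odd⇒±[1+double] : ∀ {l} → (∃ λ k → l ≡ + 2 ℤ.* k ℤ.+ + 1) →
                  ∃ λ j → l ≡ + suc (double j) ⊎ l ≡ -[1+ double j ]
odd⇒±[1+double] (+ j      , ≡.refl) = j , inj₁ (2*j+1≡odd j)
odd⇒±[1+double] (-[1+ j ] , ≡.refl) = j , inj₂ (2*[-1-j]+1≡-odd j)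

module LocalFieldProperties {r ℓ} (F : LocalField r ℓ) where
  open LocalField F
  open IntegerCoefficientRingSolver cring using (solve; _:=_; _:+_; _:*_; _:-_; con; _:^_)
  open import Algebra.Properties.Ring ring using (-1*x≈-x; -‿involutive)
  open import Relation.Binary.Reasoning.Setoid setoid

  infix 4 _≤v_
  _≤v_ : ℤ∞ → Carrier → Set
  m ≤v x = m ≤∞ v x

  _∈𝒪 : Carrier → Set
  x ∈𝒪 = fin (+ 0) ≤v x

  ≤v-cong : ∀ {m x y} → x ≈ y → m ≤v x → m ≤v y
  ≤v-cong {m} x≈y = ≡.subst (m ≤∞_) (v-cong x≈y)

  ≤v-0# : ∀ m → m ≤v 0#
  ≤v-0# m = ≡.subst (m ≤∞_) (≡.sym v-0) (m ≤∞∞)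

  ≤v-+ : ∀ {m x y} → m ≤v x → m ≤v y → m ≤v x + y
  ≤v-+ {x = x} {y} m≤x m≤y = ≤∞-trans (min∞-glb m≤x m≤y) (v-+ x y)

  ≤v-*ʳ : ∀ {m x y} → m ≤v x → y ∈𝒪 → m ≤v x * y
  ≤v-*ʳ {m} {x} {y} m≤x y∈𝒪 = ≡.subst (m ≤∞_) (≡.sym (v-* x y)) (≤∞-+∞-nonneg m≤x y∈𝒪)

  ≤v-*ˡ : ∀ {m x y} → x ∈𝒪 → m ≤v y → m ≤v x * y
  ≤v-*ˡ {x = x} {y} x∈𝒪 m≤y = ≤v-cong (*-comm y x) (≤v-*ʳ m≤y x∈𝒪)

  v-1# : v 1# ≡ fin (+ 0)
  v-1# = x≡x+∞x⇒x≡0 (v 1#) (λ v1≡∞ → 1≉0 (v-∞ 1# v1≡∞))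
           (≡.trans (v-cong (sym (*-identityˡ 1#))) (v-* 1# 1#))

  1∈𝒪 : 1# ∈𝒪
  1∈𝒪 = ≡.subst (fin (+ 0) ≤∞_) (≡.sym v-1#) (≤∞-refl _)

  -1∈𝒪 : (- 1#) ∈𝒪
  -1∈𝒪 = x+∞x≡0⇒0≤x (v (- 1#)) (≡.trans (≡.sym (v-* (- 1#) (- 1#))) (≡.trans (v-cong -1*-1≈1) v-1#))
    where
    -1*-1≈1 : - 1# * - 1# ≈ 1#
    -1*-1≈1 = trans (-1*x≈-x (- 1#)) (-‿involutive 1#)

  ≤v-neg : ∀ {m x} → m ≤v x → m ≤v - x
  ≤v-neg {x = x} m≤x = ≤v-cong (-1*x≈-x x) (≤v-*ˡ -1∈𝒪 m≤x)

  ≤v-- : ∀ {m x y} → m ≤v x → m ≤v y → m ≤v x - y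
  ≤v-- m≤x m≤y = ≤v-+ m≤x (≤v-neg m≤y)

  ^-∈𝒪 : ∀ {x} → x ∈𝒪 → ∀ n → (x ^ n) ∈𝒪
  ^-∈𝒪 x∈𝒪 zero    = 1∈𝒪
  ^-∈𝒪 x∈𝒪 (suc n) = ≤v-*ʳ x∈𝒪 (^-∈𝒪 x∈𝒪 n)

  unit⇒∈𝒪 : ∀ {x} → IsUnit𝒪 x → x ∈𝒪
  unit⇒∈𝒪 x-unit = ≡.subst (fin (+ 0) ≤∞_) (≡.sym x-unit) (≤∞-refl _)

  unit⇒≉0 : ∀ {x} → IsUnit𝒪 x → ¬ x ≈ 0#
  unit⇒≉0 x-unit x≈0 with ≡.trans (≡.sym x-unit) (≡.trans (v-cong x≈0) v-0)
  ... | ()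

  unit-* : ∀ {x y} → IsUnit𝒪 x → IsUnit𝒪 y → IsUnit𝒪 (x * y)
  unit-* {x} {y} x-unit y-unit = ≡.trans (v-* x y) (≡.cong₂ _+∞_ x-unit y-unit)

  v-unit-* : ∀ {u} x → IsUnit𝒪 u → v (u * x) ≡ v x
  v-unit-* {u} x u-unit = ≡.trans (v-* u x) (≡.trans (≡.cong (_+∞ v x) u-unit) (+∞-identityˡ (v x)))

  ≤v-cancel-unit : ∀ {m u x} → IsUnit𝒪 u → m ≤v u * x → m ≤v x
  ≤v-cancel-unit {m} {x = x} u-unit = ≡.subst (m ≤∞_) (v-unit-* x u-unit)

  inv-unit : ∀ {x} → IsUnit𝒪 x → IsUnit𝒪 (inv x)
  inv-unit {x} x-unit = ≡.trans
    (≡.sym (v-unit-* (inv x) x-unit)) (≡.trans (v-cong (inv-law x (unit⇒≉0 x-unit))) v-1#)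

  inv-involutive : ∀ {x} → IsUnit𝒪 x → inv (inv x) ≈ x
  inv-involutive {x} x-unit = begin
    inv (inv x)                 ≈⟨ *-identityˡ _ ⟨
    1# * inv (inv x)            ≈⟨ *-congʳ (inv-law x (unit⇒≉0 x-unit)) ⟨
    (x * inv x) * inv (inv x)   ≈⟨ *-assoc _ _ _ ⟩
    x * (inv x * inv (inv x))   ≈⟨ *-congˡ (inv-law (inv x) (unit⇒≉0 (inv-unit x-unit))) ⟩
    x * 1#                      ≈⟨ *-identityʳ x ⟩
    x                           ∎

  x*y*[x⁻¹+y⁻¹]≈x+y : ∀ {x y} → IsUnit𝒪 x → IsUnit𝒪 y → (x * y) * (inv x + inv y) ≈ x + y
  x*y*[x⁻¹+y⁻¹]≈x+y {x} {y} x-unit y-unit = begin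
    (x * y) * (inv x + inv y)               ≈⟨ solve 4 (λ x y x⁻¹ y⁻¹ → (x :* y) :* (x⁻¹ :+ y⁻¹)
                                                  := y :* (x :* x⁻¹) :+ x :* (y :* y⁻¹)) refl x y (inv x) (inv y) ⟩
    y * (x * inv x) + x * (y * inv y)       ≈⟨ +-cong (*-congˡ (inv-law x (unit⇒≉0 x-unit))) (*-congˡ (inv-law y (unit⇒≉0 y-unit))) ⟩
    y * 1# + x * 1#                         ≈⟨ +-cong (*-identityʳ y) (*-identityʳ x) ⟩
    y + x                                   ≈⟨ +-comm y x ⟩
    x + y                                   ∎

  v-inv-+ : ∀ {x y} → IsUnit𝒪 x → IsUnit𝒪 y → v (inv x + inv y) ≡ v (x + y)
  v-inv-+ {x} {y} x-unit y-unit = ≡.trans (≡.sym (v-unit-* _ (unit-* x-unit y-unit)))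
                                          (v-cong (x*y*[x⁻¹+y⁻¹]≈x+y x-unit y-unit))

  S-+1 : ∀ a b c d → S (+ 1) a b c d ≈ (a + b) - (c + d)
  S-+1 = solve 4 (λ a b c d → ((a :^ 1 :+ b :^ 1) :- c :^ 1) :- d :^ 1 := (a :+ b) :- (c :+ d)) refl

  S-+0 : ∀ a b c d → S (+ 0) a b c d ≈ 0#
  S-+0 _ _ _ _ = solve 1 (λ x → ((x :+ x) :- x) :- x := con (+ 0)) refl 1#

  powerSum : Carrier → Carrier → ℕ → Carrier
  powerSum x y k = x ^ k + y ^ k

  oddPowerSumQuotient : Carrier → Carrier → ℕ → Carrier
  oddPowerSumQuotient x y zero    = 1#
  oddPowerSumQuotient x y (suc j) = x * x * oddPowerSumQuotient x y j + y ^ suc (double j) * (y - x)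

  powerSum-odd : ∀ x y j → powerSum x y (suc (double j)) ≈ (x + y) * oddPowerSumQuotient x y j
  powerSum-odd x y zero    = sym (distribʳ 1# x y)
  powerSum-odd x y (suc j) = begin
    x * (x * (x * X)) + y * (y * (y * Y))
      ≈⟨ solve 4 (λ x y X Y → x :* (x :* (x :* X)) :+ y :* (y :* (y :* Y))
                 := (x :* x) :* (x :* X :+ y :* Y) :+ (y :* Y) :* ((x :+ y) :* (y :- x))) refl x y X Y ⟩
    (x * x) * powerSum x y (suc (double j)) + (y * Y) * ((x + y) * (y - x))
      ≈⟨ +-congʳ (*-congˡ (powerSum-odd x y j)) ⟩
    (x * x) * ((x + y) * q) + (y * Y) * ((x + y) * (y - x))
      ≈⟨ solve 4 (λ x y Y q → (x :* x) :* ((x :+ y) :* q) :+ (y :* Y) :* ((x :+ y) :* (y :- x))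
                 := (x :+ y) :* ((x :* x) :* q :+ (y :* Y) :* (y :- x))) refl x y Y q ⟩
    (x + y) * oddPowerSumQuotient x y (suc j) ∎
    where
    X Y q : Carrier
    X = x ^ double j
    Y = y ^ double j
    q = oddPowerSumQuotient x y j

  oddPowerSumQuotient-∈𝒪 : ∀ {x y} → x ∈𝒪 → y ∈𝒪 → ∀ j → oddPowerSumQuotient x y j ∈𝒪
  oddPowerSumQuotient-∈𝒪 x∈𝒪 y∈𝒪 zero    = 1∈𝒪
  oddPowerSumQuotient-∈𝒪 x∈𝒪 y∈𝒪 (suc j) =
    ≤v-+ (≤v-*ˡ (≤v-*ˡ x∈𝒪 x∈𝒪) (oddPowerSumQuotient-∈𝒪 x∈𝒪 y∈𝒪 j))
         (≤v-*ˡ (^-∈𝒪 y∈𝒪 (suc (double j))) (≤v-- y∈𝒪 x∈𝒪))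

  module PowerSumDifferences (a b c d : Carrier) where
    e e' p p' : Carrier
    e  = a + b
    e' = c + d
    p  = a * b
    p' = c * d

    Δ : ℕ → Carrier
    Δ k = S (+ k) a b c d

    Δ-recurrence : ∀ k → Δ (suc (suc k)) ≈ ((e * Δ (suc k) - p * Δ k) + (e - e') * powerSum c d (suc k))
                                           - (p - p') * powerSum c d k
    Δ-recurrence k = solve 8 (λ a b c d A B C D →
        (((a :* (a :* A)) :+ (b :* (b :* B))) :- (c :* (c :* C))) :- (d :* (d :* D))
     := ((((a :+ b) :* ((((a :* A) :+ (b :* B)) :- (c :* C)) :- (d :* D)))
           :- ((a :* b) :* (((A :+ B) :- C) :- D)))
          :+ (((a :+ b) :- (c :+ d)) :* ((c :* C) :+ (d :* D))))
          :- (((a :* b) :- (c :* d)) :* (C :+ D))) refl a b c d (a ^ k) (b ^ k) (c ^ k) (d ^ k)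

    e*Δ-recurrence : ∀ k → e * Δ (suc (suc k)) ≈ ((e * (e * Δ (suc k)) - p * (e * Δ k)) + (e - e') * (e * powerSum c d (suc k)))
                                                 - (e * (p - p')) * powerSum c d k
    e*Δ-recurrence k = trans (*-congˡ (Δ-recurrence k)) (solve 8 (λ e e' p p' U V Y₁ Y₀ →
        e :* ((((e :* U) :- (p :* V)) :+ ((e :- e') :* Y₁)) :- ((p :- p') :* Y₀))
     := (((e :* (e :* U)) :- (p :* (e :* V))) :+ ((e :- e') :* (e :* Y₁))) :- ((e :* (p :- p')) :* Y₀))
      refl e e' p p' (Δ (suc k)) (Δ k) (powerSum c d (suc k)) (powerSum c d k))

    e*[p-p']≈ : e * (p - p') ≈ p * (e - e') - (p' * e - p * e')
    e*[p-p']≈ = solve 4 (λ e e' p p' → e :* (p :- p') := p :* (e :- e') :- (p' :* e :- p :* e')) refl e e' p p'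

    e'*[p-p']≈ : e' * (p - p') ≈ e * (p - p') - (e - e') * (p - p')
    e'*[p-p']≈ = solve 4 (λ e e' p p' → e' :* (p :- p') := e :* (p :- p') :- (e :- e') :* (p :- p')) refl e e' p p'

    [p-p']*powerSum-odd : ∀ j → (p - p') * powerSum c d (suc (double j)) ≈ (e' * (p - p')) * oddPowerSumQuotient c d j
    [p-p']*powerSum-odd j = trans (*-congˡ (powerSum-odd c d j))
      (solve 3 (λ x e' q → x :* (e' :* q) := (e' :* x) :* q) refl (p - p') e' (oddPowerSumQuotient c d j))

    p*p'*S₋₁≈p'*e-p*e' : IsUnit𝒪 a → IsUnit𝒪 b → IsUnit𝒪 c → IsUnit𝒪 d →
                          (p * p') * S -[1+ 0 ] a b c d ≈ p' * e - p * e'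
    p*p'*S₋₁≈p'*e-p*e' a-unit b-unit c-unit d-unit = begin
      (p * p') * S -[1+ 0 ] a b c d
        ≈⟨ *-congˡ (S-+1 (inv a) (inv b) (inv c) (inv d)) ⟩
      (p * p') * ((inv a + inv b) - (inv c + inv d))
        ≈⟨ solve 4 (λ p p' A C → (p :* p') :* (A :- C) := p' :* (p :* A) :- p :* (p' :* C))
                   refl p p' (inv a + inv b) (inv c + inv d) ⟩
      p' * (p * (inv a + inv b)) - p * (p' * (inv c + inv d))
        ≈⟨ +-cong (*-congˡ (x*y*[x⁻¹+y⁻¹]≈x+y a-unit b-unit))
                  (-‿cong (*-congˡ (x*y*[x⁻¹+y⁻¹]≈x+y c-unit d-unit))) ⟩
      p' * e - p * e'
        ∎

    ≤v-e*[p-p'] : ∀ {m} → IsUnit𝒪 a → IsUnit𝒪 b → IsUnit𝒪 c → IsUnit𝒪 d →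
                  m ≤v Δ 1 → m ≤v S -[1+ 0 ] a b c d → m ≤v e * (p - p')
    ≤v-e*[p-p'] a-unit b-unit c-unit d-unit m≤Δ₁ m≤S₋₁ = ≤v-cong (sym e*[p-p']≈)
      (≤v-- (≤v-*ˡ p∈𝒪 (≤v-cong (S-+1 a b c d) m≤Δ₁))
            (≤v-cong (p*p'*S₋₁≈p'*e-p*e' a-unit b-unit c-unit d-unit) (≤v-*ˡ (≤v-*ˡ p∈𝒪 p'∈𝒪) m≤S₋₁)))
      where
      p∈𝒪 : p ∈𝒪
      p∈𝒪 = unit⇒∈𝒪 (unit-* a-unit b-unit)
      p'∈𝒪 : p' ∈𝒪
      p'∈𝒪 = unit⇒∈𝒪 (unit-* c-unit d-unit)

    module IntegralBounds (a∈𝒪 : a ∈𝒪) (b∈𝒪 : b ∈𝒪) (c∈𝒪 : c ∈𝒪) (d∈𝒪 : d ∈𝒪)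
                          {m} (m≤Δ₁ : m ≤v Δ 1) (m≤e[p-p'] : m ≤v e * (p - p')) where
      e∈𝒪 : e ∈𝒪
      e∈𝒪 = ≤v-+ a∈𝒪 b∈𝒪

      p∈𝒪 : p ∈𝒪
      p∈𝒪 = ≤v-*ˡ a∈𝒪 b∈𝒪

      powerSum-∈𝒪 : ∀ k → powerSum c d k ∈𝒪
      powerSum-∈𝒪 k = ≤v-+ (^-∈𝒪 c∈𝒪 k) (^-∈𝒪 d∈𝒪 k)

      m≤e-e' : m ≤v e - e'
      m≤e-e' = ≤v-cong (S-+1 a b c d) m≤Δ₁

      m≤e'[p-p'] : m ≤v e' * (p - p')
      m≤e'[p-p'] = ≤v-cong (sym e'*[p-p']≈) (≤v-- m≤e[p-p'] (≤v-*ʳ m≤e-e' (≤v-- p∈𝒪 (≤v-*ˡ c∈𝒪 d∈𝒪))))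

      ≤v-e*Δ : ∀ k → m ≤v e * Δ k
      ≤v-e*Δ k = proj₁ (consecutive k)
        where
        consecutive : ∀ k → m ≤v e * Δ k × m ≤v e * Δ (suc k)
        consecutive zero    = ≤v-cong (sym (trans (*-congˡ (S-+0 a b c d)) (zeroʳ e))) (≤v-0# m)
                            , ≤v-*ˡ e∈𝒪 m≤Δ₁
        consecutive (suc k) = m≤e*Δₖ₊₁ , ≤v-cong (sym (e*Δ-recurrence k))
          (≤v-- (≤v-+ (≤v-- (≤v-*ˡ e∈𝒪 m≤e*Δₖ₊₁) (≤v-*ˡ p∈𝒪 m≤e*Δₖ))
                      (≤v-*ʳ m≤e-e' (≤v-*ˡ e∈𝒪 (powerSum-∈𝒪 (suc k)))))
                (≤v-*ʳ m≤e[p-p'] (powerSum-∈𝒪 k)))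
          where
          m≤e*Δₖ : m ≤v e * Δ k
          m≤e*Δₖ = proj₁ (consecutive k)
          m≤e*Δₖ₊₁ : m ≤v e * Δ (suc k)
          m≤e*Δₖ₊₁ = proj₂ (consecutive k)

      ≤v-Δ-odd : ∀ j → m ≤v Δ (suc (double j))
      ≤v-Δ-odd zero    = m≤Δ₁
      ≤v-Δ-odd (suc j) = ≤v-cong (sym (Δ-recurrence (suc (double j))))
        (≤v-- (≤v-+ (≤v-- (≤v-e*Δ (suc (suc (double j)))) (≤v-*ˡ p∈𝒪 (≤v-Δ-odd j)))
                    (≤v-*ʳ m≤e-e' (powerSum-∈𝒪 (suc (suc (double j))))))
              (≤v-cong (sym ([p-p']*powerSum-odd j))
                       (≤v-*ʳ m≤e'[p-p'] (oddPowerSumQuotient-∈𝒪 c∈𝒪 d∈𝒪 j))))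

      ≤v-Δ-if-e-unit : IsUnit𝒪 e → ∀ k → m ≤v Δ k
      ≤v-Δ-if-e-unit e-unit k = ≤v-cancel-unit e-unit (≤v-e*Δ k)

  S₋₁-of-inverses : ∀ {a b c d} → IsUnit𝒪 a → IsUnit𝒪 b → IsUnit𝒪 c → IsUnit𝒪 d →
                    S -[1+ 0 ] (inv a) (inv b) (inv c) (inv d) ≈ S (+ 1) a b c d
  S₋₁-of-inverses {a} {b} {c} {d} a-unit b-unit c-unit d-unit = begin
    S -[1+ 0 ] (inv a) (inv b) (inv c) (inv d)
      ≈⟨ S-+1 _ _ _ _ ⟩
    (inv (inv a) + inv (inv b)) - (inv (inv c) + inv (inv d))
      ≈⟨ +-cong (+-cong (inv-involutive a-unit) (inv-involutive b-unit))
                (-‿cong (+-cong (inv-involutive c-unit) (inv-involutive d-unit))) ⟩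
    (a + b) - (c + d)
      ≈⟨ S-+1 a b c d ⟨
    S (+ 1) a b c d
      ∎

  module UnitBounds {a b c d} (a-unit : IsUnit𝒪 a) (b-unit : IsUnit𝒪 b) (c-unit : IsUnit𝒪 c) (d-unit : IsUnit𝒪 d)
                    {m} (m≤S₁ : m ≤v S (+ 1) a b c d) (m≤S₋₁ : m ≤v S -[1+ 0 ] a b c d) where
    open PowerSumDifferences a b c d
    private
      module Bounds = IntegralBounds (unit⇒∈𝒪 a-unit) (unit⇒∈𝒪 b-unit) (unit⇒∈𝒪 c-unit) (unit⇒∈𝒪 d-unit)
                                     m≤S₁ (≤v-e*[p-p'] a-unit b-unit c-unit d-unit m≤S₁ m≤S₋₁)

    ≤v-S-odd : ∀ j → m ≤v S (+ suc (double j)) a b c d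
    ≤v-S-odd = Bounds.≤v-Δ-odd

    ≤v-S-if-sum-unit : IsUnit𝒪 (a + b) → ∀ n → m ≤v S (+ n) a b c d
    ≤v-S-if-sum-unit = Bounds.≤v-Δ-if-e-unit

lemma12p2 : ∀ {c ℓ : Level} (F : LocalField c ℓ) → let open LocalField F in
    (α₁ α₂ α₃ α₄ : Carrier) →
    IsUnit𝒪 α₁ → IsUnit𝒪 α₂ → IsUnit𝒪 α₃ → IsUnit𝒪 α₄ →
    ((l : ℤ) → IsOdd l →
      min∞ (v (S (+ 1) α₁ α₂ α₃ α₄)) (v (S (-[1+ 0 ]) α₁ α₂ α₃ α₄))
        ≤∞ v (S l α₁ α₂ α₃ α₄))
    ×
    (IsUnit𝒪 (α₁ + α₂) → (l : ℤ) →
      min∞ (v (S (+ 1) α₁ α₂ α₃ α₄)) (v (S (-[1+ 0 ]) α₁ α₂ α₃ α₄))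
        ≤∞ v (S l α₁ α₂ α₃ α₄))
lemma12p2 F a b c d a-unit b-unit c-unit d-unit = odd-exponents , all-exponents
  where
  open LocalField F
  open LocalFieldProperties F
  m : ℤ∞
  m = min∞ (v (S (+ 1) a b c d)) (v (S -[1+ 0 ] a b c d))

  m≤S₁ : m ≤v S (+ 1) a b c d
  m≤S₁ = min∞-≤ˡ (v (S (+ 1) a b c d)) (v (S -[1+ 0 ] a b c d))

  m≤S₋₁ : m ≤v S -[1+ 0 ] a b c d
  m≤S₋₁ = min∞-≤ʳ (v (S (+ 1) a b c d)) (v (S -[1+ 0 ] a b c d))

  -- S -[1+ n ] at a, b, c, d is by definition S (+ suc n) at their inverses.
  module Pos = UnitBounds a-unit b-unit c-unit d-unit m≤S₁ m≤S₋₁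
  module Neg = UnitBounds (inv-unit a-unit) (inv-unit b-unit) (inv-unit c-unit) (inv-unit d-unit)
                          m≤S₋₁ (≤v-cong (sym (S₋₁-of-inverses a-unit b-unit c-unit d-unit)) m≤S₁)

  odd-exponents : (l : ℤ) → IsOdd l → m ≤v S l a b c d
  odd-exponents l l-odd with odd⇒±[1+double] l-odd
  ... | j , inj₁ ≡.refl = Pos.≤v-S-odd j
  ... | j , inj₂ ≡.refl = Neg.≤v-S-odd j

  all-exponents : IsUnit𝒪 (a + b) → (l : ℤ) → m ≤v S l a b c d
  all-exponents a+b-unit (+ n)    = Pos.≤v-S-if-sum-unit a+b-unit n
  all-exponents a+b-unit -[1+ n ] = Neg.≤v-S-if-sum-unit (≡.trans (v-inv-+ a-unit b-unit) a+b-unit) (suc n)
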